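{- Let $n$ be a non-negative integer and $s$ any integer. Then \[ \sum_{k = 0}^n \binom nk F_{k + s}^3 = \frac{1}{5}\left(2^n F_{2n + 3s} + 3F_{n - s}\right),\qquad \sum_{k = 0}^n \binom nk L_{k + s}^3 = 2^n L_{2n + 3s} + 3L_{n - s}, \] \[ \sum_{k = 0}^n (-1)^k\binom nk F_{k + s}^3 = \frac{1}{5}\left((-1)^n 2^n F_{n + 3s} - (-1)^s 3F_{2n + s}\right),\qquad \sum_{k = 0}^n (-1)^k\binom nk L_{k + s}^3 = (-1)^n 2^n L_{n + 3s} + (-1)^s 3L_{2n + s}, \] \[ \sum_{k = 0}^n \binom nk 2^k F_{k + s}^3 = \begin{cases} 5^{n/2 - 1}\left(F_{3n + 3s} - (-1)^s 3F_s\right), & n \text{ even},\\ 5^{(n - 3)/2}\left(L_{3n + 3s} + (-1)^s 3L_s\right), & n \text{ odd},\end{cases} \] \[ \sum_{k = 0}^n \binom nk 2^k L_{k + s}^3 = \begin{cases} 5^{n/2}\left(L_{3n + 3s} + (-1)^s 3L_s\right), & n \text{ even},\\ 5^{(n + 1)/2}\left(F_{3n + 3s} - (-1)^s 3F_s\right), & n \text{ odd}.\end{cases} \]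
   Context: The Fibonacci numbers $F_n$ and Lucas numbers $L_n$ are defined for all integers $n$ by $F_0=0$, $F_1=1$, $L_0=2$, $L_1=1$, $F_n=F_{n-1}+F_{n-2}$, $L_n=L_{n-1}+L_{n-2}$, extended to negative indices by $F_{ -n}=(-1)^{n-1}F_n$, $L_{ -n}=(-1)^nL_n$. -}

module Defs where

open import Data.Nat as ℕ using (ℕ; zero; suc)
open import Data.Nat.Combinatorics using (_C_)
open import Data.Integer using (ℤ; +_; -[1+_]; _+_; _*_; -_; _^_)

fibℕ : ℕ → ℕ
fibℕ 0 = 0
fibℕ 1 = 1
fibℕ (suc (suc n)) = fibℕ (suc n) ℕ.+ fibℕ n

lucℕ : ℕ → ℕ
lucℕ 0 = 2
lucℕ 1 = 1
lucℕ (suc (suc n)) = lucℕ (suc n) ℕ.+ lucℕ n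

negOnePowℕ : ℕ → ℤ
negOnePowℕ zero = + 1
negOnePowℕ (suc n) = - negOnePowℕ n

-- (-1)^s for integer s (depends only on parity; (-1)^(-m) = (-1)^m)
negOnePow : ℤ → ℤ
negOnePow (+ n) = negOnePowℕ n
negOnePow -[1+ n ] = negOnePowℕ (suc n)

-- F and L extended to all integers:
-- F_{-n} = (-1)^(n-1) F_n,  L_{-n} = (-1)^n L_n
F : ℤ → ℤ
F (+ n) = + fibℕ n
F -[1+ n ] = negOnePowℕ n * + fibℕ (suc n)

L : ℤ → ℤ
L (+ n) = + lucℕ n
L -[1+ n ] = negOnePowℕ (suc n) * + lucℕ (suc n)

sumTo : ℕ → (ℕ → ℤ) → ℤ
sumTo zero f = f 0
sumTo (suc n) f = sumTo n f + f (suc n)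

binom : ℕ → ℕ → ℤ
binom n k = + (n C k)

{-# OPTIONS --safe #-}
-- The cubing identities 5 F_x³ = F_{3x} + 3 F_{-x} and L_x³ = L_{3x} + 3 L_{-x} split every sum into
-- binomial sums Σ_k C(n,k) w^k f(x + k d) with f ∈ {F, L}. Such a sum is the n-th iterate of the
-- operator f ↦ f + w f(· + d) evaluated at x, and for each weight occurring here the operator maps F and L
-- to constant multiples of shifts of F or L (F_y + F_{y+3} = 2 F_{y+2}, F_y + 2 F_{y+3} = L_{y+3},
-- L_y + 2 L_{y+3} = 5 F_{y+3}, ...), so each sum collapses to a single term times a power of 2 or 5.
module Submission where

open import Data.Nat as ℕ using (ℕ; zero; suc)
import Data.Nat.Properties as ℕP
open import Data.Nat.Combinatorics using (_C_; nCk+nC[k+1]≡[n+1]C[k+1]; k>n⇒nCk≡0)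
open import Data.Integer using (ℤ; +_; -[1+_]; _+_; _-_; _*_; -_; _^_; -1ℤ; 1ℤ)
  renaming (suc to sucℤ)
open import Data.Integer.Properties
  using (+-0-abelianGroup; +-assoc; +-comm; +-identityˡ; +-identityʳ; *-assoc; *-identityˡ;
         *-distribˡ-+; *-distribʳ-+; neg-involutive; neg-distribˡ-*; -1*i≡-i; pos-*; ^-zeroˡ)
open import Algebra.Properties.AbelianGroup +-0-abelianGroup using () renaming (∙-cancelˡ to +-cancelˡ)
open import Data.Integer.Tactic.RingSolver using (solve-∀)
open import Data.Product using (_×_; _,_; proj₁)
open import Relation.Binary.PropositionalEquality
open ≡-Reasoning

open import Defs

negOnePow-suc : ∀ x → negOnePow (sucℤ x) ≡ - negOnePow x
negOnePow-suc (+ n)        = refl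
negOnePow-suc -[1+ zero ]  = refl
negOnePow-suc -[1+ suc n ] = sym (neg-involutive (negOnePowℕ (suc n)))

negOnePow-+ : ∀ k x → negOnePow (+ k + x) ≡ negOnePowℕ k * negOnePow x
negOnePow-+ zero    x = trans (cong negOnePow (+-identityˡ x)) (sym (*-identityˡ (negOnePow x)))
negOnePow-+ (suc k) x = begin
  negOnePow (+ suc k + x)          ≡⟨ cong negOnePow (+-assoc 1ℤ (+ k) x) ⟩
  negOnePow (sucℤ (+ k + x))       ≡⟨ negOnePow-suc (+ k + x) ⟩
  - negOnePow (+ k + x)            ≡⟨ cong -_ (negOnePow-+ k x) ⟩
  - (negOnePowℕ k * negOnePow x)   ≡⟨ neg-distribˡ-* (negOnePowℕ k) (negOnePow x) ⟩
  negOnePowℕ (suc k) * negOnePow x ∎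

negOnePowℕ-square : ∀ k → negOnePowℕ k * negOnePowℕ k ≡ 1ℤ
negOnePowℕ-square zero    = refl
negOnePowℕ-square (suc k) = trans (neg*neg (negOnePowℕ k)) (negOnePowℕ-square k)
  where
  neg*neg : ∀ e → (- e) * (- e) ≡ e * e
  neg*neg = solve-∀

negOnePowℕ*^ : ∀ k a → negOnePowℕ k * a ^ k ≡ (- a) ^ k
negOnePowℕ*^ zero    a = refl
negOnePowℕ*^ (suc k) a = trans (regroup (negOnePowℕ k) a (a ^ k)) (cong ((- a) *_) (negOnePowℕ*^ k a))
  where
  regroup : ∀ e a p → (- e) * (a * p) ≡ (- a) * (e * p)
  regroup = solve-∀

negOnePowℕ≡-1^ : ∀ k → negOnePowℕ k ≡ -1ℤ ^ k
negOnePowℕ≡-1^ zero    = refl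
negOnePowℕ≡-1^ (suc k) = trans (cong -_ (negOnePowℕ≡-1^ k)) (sym (-1*i≡-i (-1ℤ ^ k)))

1^*-identity : ∀ n z → 1ℤ ^ n * z ≡ z
1^*-identity n z = trans (cong (_* z) (^-zeroˡ n)) (*-identityˡ z)

ℤ-induction : (P : ℤ → Set) → P (+ 0) → (∀ x → P x → P (sucℤ x)) → (∀ x → P (sucℤ x) → P x) →
              ∀ x → P x
ℤ-induction P p₀ up down (+ zero)     = p₀
ℤ-induction P p₀ up down (+ suc n)    = up (+ n) (ℤ-induction P p₀ up down (+ n))
ℤ-induction P p₀ up down -[1+ zero ]  = down -[1+ zero ] p₀
ℤ-induction P p₀ up down -[1+ suc n ] = down -[1+ suc n ] (ℤ-induction P p₀ up down -[1+ n ])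

FibRec : (ℤ → ℤ) → Set
FibRec g = ∀ x → g (sucℤ (sucℤ x)) ≡ g (sucℤ x) + g x

FibRec-unique : ∀ g h → FibRec g → FibRec h → g (+ 0) ≡ h (+ 0) → g (+ 1) ≡ h (+ 1) →
                ∀ x → g x ≡ h x
FibRec-unique g h g-rec h-rec eq₀ eq₁ x = proj₁ (ℤ-induction P (eq₀ , eq₁) up down x)
  where
  P : ℤ → Set
  P x = g x ≡ h x × g (sucℤ x) ≡ h (sucℤ x)
  up : ∀ x → P x → P (sucℤ x)
  up x (p , q) = q , trans (g-rec x) (trans (cong₂ _+_ q p) (sym (h-rec x)))
  down : ∀ x → P (sucℤ x) → P x
  down x (p , q) = +-cancelˡ (h (sucℤ x)) (g x) (h x) step , p
    where
    step : h (sucℤ x) + g x ≡ h (sucℤ x) + h x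
    step = begin
      h (sucℤ x) + g x  ≡⟨ cong (_+ g x) p ⟨
      g (sucℤ x) + g x  ≡⟨ g-rec x ⟨
      g (sucℤ (sucℤ x)) ≡⟨ q ⟩
      h (sucℤ (sucℤ x)) ≡⟨ h-rec x ⟩
      h (sucℤ x) + h x  ∎

FibRec-shift : ∀ g → FibRec g → ∀ y → FibRec (λ x → g (x + y))
FibRec-shift g g-rec y x = begin
  g (sucℤ (sucℤ x) + y)        ≡⟨ cong g (trans (+-assoc 1ℤ (sucℤ x) y) (cong sucℤ (+-assoc 1ℤ x y))) ⟩
  g (sucℤ (sucℤ (x + y)))      ≡⟨ g-rec (x + y) ⟩
  g (sucℤ (x + y)) + g (x + y) ≡⟨ cong (λ z → g z + g (x + y)) (+-assoc 1ℤ x y) ⟨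
  g (sucℤ x + y) + g (x + y)   ∎

FibRec-combination : ∀ g → FibRec g → ∀ α β → FibRec (λ x → α * g (sucℤ x) + β * g x)
FibRec-combination g g-rec α β x = begin
  α * g (sucℤ (sucℤ (sucℤ x))) + β * g (sucℤ (sucℤ x))
    ≡⟨ cong₂ (λ u v → α * u + β * v) (g-rec (sucℤ x)) (g-rec x) ⟩
  α * (g (sucℤ (sucℤ x)) + g (sucℤ x)) + β * (g (sucℤ x) + g x)
    ≡⟨ regroup α β (g (sucℤ (sucℤ x))) (g (sucℤ x)) (g x) ⟩
  (α * g (sucℤ (sucℤ x)) + β * g (sucℤ x)) + (α * g (sucℤ x) + β * g x) ∎
  where
  regroup : ∀ α β p q r → α * (p + q) + β * (q + r) ≡ (α * p + β * q) + (α * q + β * r)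
  regroup = solve-∀

F-rec : FibRec F
F-rec (+ n)                = refl
F-rec -[1+ zero ]          = refl
F-rec -[1+ suc zero ]      = refl
F-rec -[1+ suc (suc n) ]   = alternate (negOnePowℕ n) (+ fibℕ (suc n)) (+ fibℕ (suc (suc n)))
  where
  alternate : ∀ e p q → e * p ≡ (- e) * q + (- - e) * (q + p)
  alternate = solve-∀

L-rec : FibRec L
L-rec (+ n)                = refl
L-rec -[1+ zero ]          = refl
L-rec -[1+ suc zero ]      = refl
L-rec -[1+ suc (suc n) ]   = alternate (negOnePowℕ (suc n)) (+ lucℕ (suc n)) (+ lucℕ (suc (suc n)))
  where
  alternate : ∀ e p q → e * p ≡ (- e) * q + (- - e) * (q + p)
  alternate = solve-∀

-- Both sides solve the recurrence in x and agree at x = 0, 1.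
addition-formula : ∀ g → FibRec g → ∀ x y → g (x + y) ≡ g y * F (sucℤ x) + (g (sucℤ y) - g y) * F x
addition-formula g g-rec x y =
  FibRec-unique (λ x → g (x + y)) (λ x → g y * F (sucℤ x) + (g (sucℤ y) - g y) * F x)
    (FibRec-shift g g-rec y) (FibRec-combination F F-rec (g y) (g (sucℤ y) - g y))
    (trans (cong g (+-identityˡ y)) (at-0 (g y) (g (sucℤ y)))) (at-1 (g y) (g (sucℤ y))) x
  where
  at-0 : ∀ a b → a ≡ a * + 1 + (b - a) * + 0
  at-0 = solve-∀
  at-1 : ∀ a b → b ≡ a * + 1 + (b - a) * + 1
  at-1 = solve-∀

L-via-F : ∀ x → L x ≡ + 2 * F (sucℤ x) - F x
L-via-F x = begin
  L x                                  ≡⟨ cong L (+-identityʳ x) ⟨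
  L (x + + 0)                          ≡⟨ addition-formula L L-rec x (+ 0) ⟩
  + 2 * F (sucℤ x) + -1ℤ * F x         ≡⟨ tidy (F x) (F (sucℤ x)) ⟩
  + 2 * F (sucℤ x) - F x               ∎
  where
  tidy : ∀ a b → + 2 * b + -1ℤ * a ≡ + 2 * b - a
  tidy = solve-∀

cassini : ∀ x → negOnePow x ≡ F (sucℤ x) * F (sucℤ x) - F x * F (sucℤ x) - F x * F x
cassini = ℤ-induction P refl up down
  where
  Q : ℤ → ℤ → ℤ
  Q a b = b * b - a * b - a * a
  P : ℤ → Set
  P x = negOnePow x ≡ Q (F x) (F (sucℤ x))
  Q-step : ∀ a b → (b + a) * (b + a) - b * (b + a) - b * b ≡ - (b * b - a * b - a * a)
  Q-step = solve-∀
  up : ∀ x → P x → P (sucℤ x)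
  up x p = begin
    negOnePow (sucℤ x)                  ≡⟨ negOnePow-suc x ⟩
    - negOnePow x                       ≡⟨ cong -_ p ⟩
    - Q (F x) (F (sucℤ x))              ≡⟨ Q-step (F x) (F (sucℤ x)) ⟨
    Q (F (sucℤ x)) (F (sucℤ x) + F x)   ≡⟨ cong (Q (F (sucℤ x))) (F-rec x) ⟨
    Q (F (sucℤ x)) (F (sucℤ (sucℤ x)))  ∎
  down : ∀ x → P (sucℤ x) → P x
  down x p = begin
    negOnePow x                           ≡⟨ neg-involutive (negOnePow x) ⟨
    - - negOnePow x                       ≡⟨ cong -_ (negOnePow-suc x) ⟨
    - negOnePow (sucℤ x)                  ≡⟨ cong -_ p ⟩
    - Q (F (sucℤ x)) (F (sucℤ (sucℤ x)))  ≡⟨ cong (λ z → - Q (F (sucℤ x)) z) (F-rec x) ⟩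
    - Q (F (sucℤ x)) (F (sucℤ x) + F x)   ≡⟨ cong -_ (Q-step (F x) (F (sucℤ x))) ⟩
    - - Q (F x) (F (sucℤ x))              ≡⟨ neg-involutive (Q (F x) (F (sucℤ x))) ⟩
    Q (F x) (F (sucℤ x))                  ∎

F-double : ∀ x → F (x + x) ≡ F x * (+ 2 * F (sucℤ x) - F x)
F-double x = trans (addition-formula F F-rec x x) (tidy (F x) (F (sucℤ x)))
  where
  tidy : ∀ a b → a * b + (b - a) * a ≡ a * (+ 2 * b - a)
  tidy = solve-∀

F-double-suc : ∀ x → F (sucℤ (x + x)) ≡ F x * F x + F (sucℤ x) * F (sucℤ x)
F-double-suc x = begin
  F (sucℤ (x + x))                                                    ≡⟨ cong F (index x) ⟩
  F (x + sucℤ x)                                                      ≡⟨ addition-formula F F-rec x (sucℤ x) ⟩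
  F (sucℤ x) * F (sucℤ x) + (F (sucℤ (sucℤ x)) - F (sucℤ x)) * F x   ≡⟨ cong (λ z → F (sucℤ x) * F (sucℤ x) + (z - F (sucℤ x)) * F x) (F-rec x) ⟩
  F (sucℤ x) * F (sucℤ x) + (F (sucℤ x) + F x - F (sucℤ x)) * F x    ≡⟨ tidy (F x) (F (sucℤ x)) ⟩
  F x * F x + F (sucℤ x) * F (sucℤ x)                                 ∎
  where
  index : ∀ x → 1ℤ + (x + x) ≡ x + (1ℤ + x)
  index = solve-∀
  tidy : ∀ a b → b * b + (b + a - b) * a ≡ a * a + b * b
  tidy = solve-∀

F-triple : ∀ x → F (+ 3 * x) ≡ F x * (+ 2 * F x * F x - + 3 * F x * F (sucℤ x) + + 3 * F (sucℤ x) * F (sucℤ x))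
F-triple x = begin
  F (+ 3 * x)                                           ≡⟨ cong F (index x) ⟩
  F (x + (x + x))                                       ≡⟨ addition-formula F F-rec x (x + x) ⟩
  F (x + x) * F (sucℤ x) + (F (sucℤ (x + x)) - F (x + x)) * F x
    ≡⟨ cong₂ (λ u v → u * F (sucℤ x) + (v - u) * F x) (F-double x) (F-double-suc x) ⟩
  F x * (+ 2 * F (sucℤ x) - F x) * F (sucℤ x)
    + (F x * F x + F (sucℤ x) * F (sucℤ x) - F x * (+ 2 * F (sucℤ x) - F x)) * F x
    ≡⟨ tidy (F x) (F (sucℤ x)) ⟩
  F x * (+ 2 * F x * F x - + 3 * F x * F (sucℤ x) + + 3 * F (sucℤ x) * F (sucℤ x)) ∎
  where
  index : ∀ x → + 3 * x ≡ x + (x + x)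
  index = solve-∀
  tidy : ∀ a b → a * (+ 2 * b - a) * b + (a * a + b * b - a * (+ 2 * b - a)) * a
               ≡ a * (+ 2 * a * a - + 3 * a * b + + 3 * b * b)
  tidy = solve-∀

F-triple-suc : ∀ x → F (sucℤ (+ 3 * x)) ≡ F (sucℤ x) ^ 3 + + 3 * F x * F x * F (sucℤ x) - F x ^ 3
F-triple-suc x = begin
  F (sucℤ (+ 3 * x))                                    ≡⟨ cong F (index x) ⟩
  F (x + sucℤ (x + x))                                  ≡⟨ addition-formula F F-rec x (sucℤ (x + x)) ⟩
  F (sucℤ (x + x)) * F (sucℤ x) + (F (sucℤ (sucℤ (x + x))) - F (sucℤ (x + x))) * F x
    ≡⟨ cong (λ z → F (sucℤ (x + x)) * F (sucℤ x) + (z - F (sucℤ (x + x))) * F x) (F-rec (x + x)) ⟩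
  F (sucℤ (x + x)) * F (sucℤ x) + (F (sucℤ (x + x)) + F (x + x) - F (sucℤ (x + x))) * F x
    ≡⟨ cong₂ (λ u v → v * F (sucℤ x) + (v + u - v) * F x) (F-double x) (F-double-suc x) ⟩
  (F x * F x + F (sucℤ x) * F (sucℤ x)) * F (sucℤ x)
    + (F x * F x + F (sucℤ x) * F (sucℤ x) + F x * (+ 2 * F (sucℤ x) - F x)
       - (F x * F x + F (sucℤ x) * F (sucℤ x))) * F x
    ≡⟨ tidy (F x) (F (sucℤ x)) ⟩
  F (sucℤ x) ^ 3 + + 3 * F x * F x * F (sucℤ x) - F x ^ 3 ∎
  where
  index : ∀ x → 1ℤ + + 3 * x ≡ x + (1ℤ + (x + x))
  index = solve-∀
  tidy : ∀ a b → (a * a + b * b) * b + (a * a + b * b + a * (+ 2 * b - a) - (a * a + b * b)) * a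
               ≡ b * (b * (b * 1ℤ)) + + 3 * a * a * b - a * (a * (a * 1ℤ))
  tidy = solve-∀

F-reflection : ∀ x → F (- x) ≡ -1ℤ * (negOnePow x * F x)
F-reflection (+ zero)  = refl
F-reflection (+ suc n) = flip (negOnePowℕ n) (+ fibℕ (suc n))
  where
  flip : ∀ e f → e * f ≡ -1ℤ * ((- e) * f)
  flip = solve-∀
F-reflection -[1+ n ]  = sym (begin
  -1ℤ * ((- e) * (e * f)) ≡⟨ regroup e f ⟩
  (e * e) * f             ≡⟨ cong (_* f) (negOnePowℕ-square n) ⟩
  1ℤ * f                  ≡⟨ *-identityˡ f ⟩
  f                       ∎)
  where
  e = negOnePowℕ n
  f = + fibℕ (suc n)
  regroup : ∀ e f → -1ℤ * ((- e) * (e * f)) ≡ (e * e) * f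
  regroup = solve-∀

L-reflection : ∀ x → L (- x) ≡ negOnePow x * L x
L-reflection (+ zero)  = refl
L-reflection (+ suc n) = refl
L-reflection -[1+ n ]  = sym (begin
  e * (e * l) ≡⟨ *-assoc e e l ⟨
  (e * e) * l ≡⟨ cong (_* l) (negOnePowℕ-square (suc n)) ⟩
  1ℤ * l      ≡⟨ *-identityˡ l ⟩
  l           ∎)
  where
  e = negOnePowℕ (suc n)
  l = + lucℕ (suc n)

F-cube : ∀ x → + 5 * F x ^ 3 ≡ F (+ 3 * x) + + 3 * F (- x)
F-cube x rewrite F-reflection x | F-triple x | cassini x = tidy (F x) (F (sucℤ x))
  where
  tidy : ∀ a b → + 5 * (a * (a * (a * 1ℤ)))
               ≡ a * (+ 2 * a * a - + 3 * a * b + + 3 * b * b) + + 3 * (-1ℤ * ((b * b - a * b - a * a) * a))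
  tidy = solve-∀

L-cube : ∀ x → L x ^ 3 ≡ L (+ 3 * x) + + 3 * L (- x)
L-cube x rewrite L-reflection x | L-via-F (+ 3 * x) | L-via-F x | F-triple-suc x | F-triple x | cassini x =
  tidy (F x) (F (sucℤ x))
  where
  tidy : ∀ a b → let l = + 2 * b - a in
         l * (l * (l * 1ℤ))
           ≡ + 2 * (b * (b * (b * 1ℤ)) + + 3 * a * a * b - a * (a * (a * 1ℤ)))
             - a * (+ 2 * a * a - + 3 * a * b + + 3 * b * b)
             + + 3 * ((b * b - a * b - a * a) * l)
  tidy = solve-∀


sumTo-cong : ∀ n {f g : ℕ → ℤ} → (∀ k → f k ≡ g k) → sumTo n f ≡ sumTo n g
sumTo-cong zero    f≗g = f≗g 0
sumTo-cong (suc n) f≗g = cong₂ _+_ (sumTo-cong n f≗g) (f≗g (suc n))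

sumTo-+ : ∀ n (f g : ℕ → ℤ) → sumTo n (λ k → f k + g k) ≡ sumTo n f + sumTo n g
sumTo-+ zero    f g = refl
sumTo-+ (suc n) f g = trans (cong (_+ (f (suc n) + g (suc n))) (sumTo-+ n f g))
                            (swap (sumTo n f) (sumTo n g) (f (suc n)) (g (suc n)))
  where
  swap : ∀ a b c d → (a + b) + (c + d) ≡ (a + c) + (b + d)
  swap = solve-∀

sumTo-* : ∀ n c (f : ℕ → ℤ) → sumTo n (λ k → c * f k) ≡ c * sumTo n f
sumTo-* zero    c f = refl
sumTo-* (suc n) c f = trans (cong (_+ c * f (suc n)) (sumTo-* n c f))
                            (sym (*-distribˡ-+ c (sumTo n f) (f (suc n))))

sumTo-head : ∀ n (f : ℕ → ℤ) → sumTo (suc n) f ≡ f 0 + sumTo n (λ k → f (suc k))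
sumTo-head zero    f = refl
sumTo-head (suc n) f = trans (cong (_+ f (suc (suc n))) (sumTo-head n f))
                             (+-assoc (f 0) (sumTo n (λ k → f (suc k))) (f (suc (suc n))))

binomialTransform : ℕ → (ℕ → ℤ) → ℤ
binomialTransform n h = sumTo n (λ k → binom n k * h k)

binomialTransform-cong : ∀ n {h h′ : ℕ → ℤ} → (∀ k → h k ≡ h′ k) →
                         binomialTransform n h ≡ binomialTransform n h′
binomialTransform-cong n h≗h′ = sumTo-cong n (λ k → cong (binom n k *_) (h≗h′ k))

binomialTransform-* : ∀ n c h → binomialTransform n (λ k → c * h k) ≡ c * binomialTransform n h
binomialTransform-* n c h =
  trans (sumTo-cong n (λ k → swap (binom n k) c (h k))) (sumTo-* n c (λ k → binom n k * h k))
  where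
  swap : ∀ b c x → b * (c * x) ≡ c * (b * x)
  swap = solve-∀

binomialTransform-+ : ∀ n h h′ →
  binomialTransform n (λ k → h k + h′ k) ≡ binomialTransform n h + binomialTransform n h′
binomialTransform-+ n h h′ =
  trans (sumTo-cong n (λ k → *-distribˡ-+ (binom n k) (h k) (h′ k))) (sumTo-+ n _ _)

binomialTransform-linear : ∀ n c h h′ →
  binomialTransform n (λ k → h k + c * h′ k) ≡ binomialTransform n h + c * binomialTransform n h′
binomialTransform-linear n c h h′ =
  trans (binomialTransform-+ n h (λ k → c * h′ k)) (cong (_+_ (binomialTransform n h)) (binomialTransform-* n c h′))

-- Pascal's rule; the extra term C(n, n+1) h(n+1) of the shifted sum vanishes.
binomialTransform-suc : ∀ n h →
  binomialTransform (suc n) h ≡ binomialTransform n h + binomialTransform n (λ k → h (suc k))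
binomialTransform-suc n h = begin
  binomialTransform (suc n) h
    ≡⟨ sumTo-head n (λ k → binom (suc n) k * h k) ⟩
  1ℤ * h 0 + sumTo n (λ k → binom (suc n) (suc k) * h (suc k))
    ≡⟨ cong (_+_ (1ℤ * h 0)) (trans (sumTo-cong n pascal) (sumTo-+ n _ _)) ⟩
  1ℤ * h 0 + (binomialTransform n (λ k → h (suc k)) + tail)
    ≡⟨ regroup (1ℤ * h 0) (binomialTransform n (λ k → h (suc k))) tail ⟩
  (1ℤ * h 0 + tail) + binomialTransform n (λ k → h (suc k))
    ≡⟨ cong (_+ binomialTransform n (λ k → h (suc k))) untruncated ⟩
  binomialTransform n h + binomialTransform n (λ k → h (suc k)) ∎
  where
  tail = sumTo n (λ k → binom n (suc k) * h (suc k))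
  pascal : ∀ k → binom (suc n) (suc k) * h (suc k) ≡ binom n k * h (suc k) + binom n (suc k) * h (suc k)
  pascal k = trans (cong (λ m → + m * h (suc k)) (sym (nCk+nC[k+1]≡[n+1]C[k+1] n k)))
                   (*-distribʳ-+ (h (suc k)) (binom n k) (binom n (suc k)))
  regroup : ∀ a b c → a + (b + c) ≡ (a + c) + b
  regroup = solve-∀
  untruncated : 1ℤ * h 0 + tail ≡ binomialTransform n h
  untruncated = begin
    1ℤ * h 0 + tail                                           ≡⟨ sumTo-head n (λ k → binom n k * h k) ⟨
    binomialTransform n h + binom n (suc n) * h (suc n)       ≡⟨ cong (λ m → binomialTransform n h + + m * h (suc n)) (k>n⇒nCk≡0 (ℕP.n<1+n n)) ⟩
    binomialTransform n h + + 0 * h (suc n)                   ≡⟨ +-identityʳ (binomialTransform n h) ⟩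
    binomialTransform n h                                     ∎

binomialSum : ℤ → ℤ → (ℤ → ℤ) → ℕ → ℤ → ℤ
binomialSum w d f n x = binomialTransform n (λ k → w ^ k * f (x + + k * d))

binomialSum-cong : ∀ w d {f f′} → (∀ y → f y ≡ f′ y) → ∀ n x → binomialSum w d f n x ≡ binomialSum w d f′ n x
binomialSum-cong w d f≗f′ n x = binomialTransform-cong n (λ k → cong (w ^ k *_) (f≗f′ (x + + k * d)))

binomialSum-zero : ∀ w d f x → binomialSum w d f 0 x ≡ f x
binomialSum-zero w d f x = trans (*-identityˡ _) (trans (*-identityˡ _) (cong f (+-identityʳ x)))

binomialSum-suc : ∀ w d f n x →
  binomialSum w d f (suc n) x ≡ binomialSum w d (λ y → f y + w * f (y + d)) n x
binomialSum-suc w d f n x = begin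
  binomialTransform (suc n) H                         ≡⟨ binomialTransform-suc n H ⟩
  binomialTransform n H + binomialTransform n (λ k → H (suc k))
    ≡⟨ cong (_+_ (binomialTransform n H)) (trans (binomialTransform-cong n H-suc) (binomialTransform-* n w H′)) ⟩
  binomialTransform n H + w * binomialTransform n H′  ≡⟨ binomialTransform-linear n w H H′ ⟨
  binomialTransform n (λ k → H k + w * H′ k)          ≡⟨ binomialTransform-cong n (λ k → factor (w ^ k) w _ _) ⟩
  binomialSum w d (λ y → f y + w * f (y + d)) n x     ∎
  where
  H H′ : ℕ → ℤ
  H  k = w ^ k * f (x + + k * d)
  H′ k = w ^ k * f (x + + k * d + d)
  index : ∀ x k d → x + (1ℤ + k) * d ≡ x + k * d + d
  index = solve-∀
  H-suc : ∀ k → H (suc k) ≡ w * H′ k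
  H-suc k = trans (cong (λ y → w ^ suc k * f y) (index x (+ k) d)) (*-assoc w (w ^ k) _)
  factor : ∀ p w a b → p * a + w * (p * b) ≡ p * (a + w * b)
  factor = solve-∀

binomialSum-scale-shift : ∀ w d a e g n x →
  binomialSum w d (λ y → a * g (y + e)) n x ≡ a * binomialSum w d g n (x + e)
binomialSum-scale-shift w d a e g n x =
  trans (binomialTransform-cong n summand) (binomialTransform-* n a (λ k → w ^ k * g (x + e + + k * d)))
  where
  index : ∀ x k d e → x + k * d + e ≡ x + e + k * d
  index = solve-∀
  swap : ∀ p a z → p * (a * z) ≡ a * (p * z)
  swap = solve-∀
  summand : ∀ k → w ^ k * (a * g (x + + k * d + e)) ≡ a * (w ^ k * g (x + e + + k * d))
  summand k = trans (cong (λ y → w ^ k * (a * g y)) (index x (+ k) d e)) (swap (w ^ k) a _)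

binomialSum-step : ∀ w d a e f g → (∀ y → f y + w * f (y + d) ≡ a * g (y + e)) →
  ∀ n x → binomialSum w d f (suc n) x ≡ a * binomialSum w d g n (x + e)
binomialSum-step w d a e f g step n x =
  trans (binomialSum-suc w d f n x) (trans (binomialSum-cong w d step n x) (binomialSum-scale-shift w d a e g n x))

binomialSum-geometric : ∀ w d a e f → (∀ y → f y + w * f (y + d) ≡ a * f (y + e)) →
  ∀ n x → binomialSum w d f n x ≡ a ^ n * f (x + + n * e)
binomialSum-geometric w d a e f step zero x =
  trans (binomialSum-zero w d f x) (sym (trans (*-identityˡ _) (cong f (+-identityʳ x))))
binomialSum-geometric w d a e f step (suc n) x = begin
  binomialSum w d f (suc n) x             ≡⟨ binomialSum-step w d a e f f step n x ⟩
  a * binomialSum w d f n (x + e)         ≡⟨ cong (a *_) (binomialSum-geometric w d a e f step n (x + e)) ⟩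
  a * (a ^ n * f (x + e + + n * e))       ≡⟨ *-assoc a (a ^ n) _ ⟨
  a ^ suc n * f (x + e + + n * e)         ≡⟨ cong (λ y → a ^ suc n * f y) (index x (+ n) e) ⟩
  a ^ suc n * f (x + + suc n * e)         ∎
  where
  index : ∀ x n e → x + e + n * e ≡ x + (1ℤ + n) * e
  index = solve-∀

binomialSum-even : ∀ w d a b e f g →
  (∀ y → f y + w * f (y + d) ≡ a * g (y + e)) → (∀ y → g y + w * g (y + d) ≡ b * f (y + e)) →
  ∀ m x → binomialSum w d f (2 ℕ.* m) x ≡ (a * b) ^ m * f (x + + (2 ℕ.* m) * e)
binomialSum-even w d a b e f g f-step g-step zero x =
  trans (binomialSum-zero w d f x) (sym (trans (*-identityˡ _) (cong f (+-identityʳ x))))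
binomialSum-even w d a b e f g f-step g-step (suc m) x = begin
  binomialSum w d f (2 ℕ.* suc m) x
    ≡⟨ cong (λ n → binomialSum w d f n x) (ℕP.*-suc 2 m) ⟩
  binomialSum w d f (suc (suc (2 ℕ.* m))) x
    ≡⟨ binomialSum-step w d a e f g f-step (suc (2 ℕ.* m)) x ⟩
  a * binomialSum w d g (suc (2 ℕ.* m)) (x + e)
    ≡⟨ cong (a *_) (binomialSum-step w d b e g f g-step (2 ℕ.* m) (x + e)) ⟩
  a * (b * binomialSum w d f (2 ℕ.* m) (x + e + e))
    ≡⟨ cong (λ z → a * (b * z)) (binomialSum-even w d a b e f g f-step g-step m (x + e + e)) ⟩
  a * (b * ((a * b) ^ m * f (x + e + e + + (2 ℕ.* m) * e)))
    ≡⟨ regroup a b ((a * b) ^ m) _ ⟩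
  (a * b) ^ suc m * f (x + e + e + + (2 ℕ.* m) * e)
    ≡⟨ cong (λ y → (a * b) ^ suc m * f y) (trans (index x (+ (2 ℕ.* m)) e) (cong (λ n → x + + n * e) (sym (ℕP.*-suc 2 m)))) ⟩
  (a * b) ^ suc m * f (x + + (2 ℕ.* suc m) * e) ∎
  where
  regroup : ∀ a b p z → a * (b * (p * z)) ≡ (a * b) * p * z
  regroup = solve-∀
  index : ∀ x n e → x + e + e + n * e ≡ x + (1ℤ + (1ℤ + n)) * e
  index = solve-∀

binomialSum-odd : ∀ w d a b e f g →
  (∀ y → f y + w * f (y + d) ≡ a * g (y + e)) → (∀ y → g y + w * g (y + d) ≡ b * f (y + e)) →
  ∀ m x → binomialSum w d f (suc (2 ℕ.* m)) x ≡ a * ((b * a) ^ m * g (x + e + + (2 ℕ.* m) * e))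
binomialSum-odd w d a b e f g f-step g-step m x =
  trans (binomialSum-step w d a e f g f-step (2 ℕ.* m) x) (cong (a *_) (binomialSum-even w d b a e g f g-step f-step m (x + e)))

shift-expansion : ∀ g → FibRec g → ∀ c y → g (y + + c) ≡ g y * F (+ suc c) + (g (sucℤ y) - g y) * F (+ c)
shift-expansion g g-rec c y = trans (cong g (+-comm y (+ c))) (addition-formula g g-rec (+ c) y)

FibRec-consecutive : ∀ g → FibRec g → ∀ y → g y + 1ℤ * g (y + 1ℤ) ≡ 1ℤ * g (y + + 2)
FibRec-consecutive g g-rec y rewrite shift-expansion g g-rec 1 y | shift-expansion g g-rec 2 y =
  tidy (g y) (g (sucℤ y))
  where
  tidy : ∀ a b → a + 1ℤ * (a * + 1 + (b - a) * + 1) ≡ 1ℤ * (a * + 2 + (b - a) * + 1)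
  tidy = solve-∀

FibRec-step-3 : ∀ g → FibRec g → ∀ y → g y + 1ℤ * g (y + + 3) ≡ + 2 * g (y + + 2)
FibRec-step-3 g g-rec y rewrite shift-expansion g g-rec 3 y | shift-expansion g g-rec 2 y =
  tidy (g y) (g (sucℤ y))
  where
  tidy : ∀ a b → a + 1ℤ * (a * + 3 + (b - a) * + 2) ≡ + 2 * (a * + 2 + (b - a) * + 1)
  tidy = solve-∀

FibRec-alternating-step-3 : ∀ g → FibRec g → ∀ y → g y + -1ℤ * g (y + + 3) ≡ - + 2 * g (y + 1ℤ)
FibRec-alternating-step-3 g g-rec y rewrite shift-expansion g g-rec 3 y | shift-expansion g g-rec 1 y =
  tidy (g y) (g (sucℤ y))
  where
  tidy : ∀ a b → a + -1ℤ * (a * + 3 + (b - a) * + 2) ≡ - + 2 * (a * + 1 + (b - a) * + 1)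
  tidy = solve-∀

FibRec-reflected-step : ∀ g → FibRec g → ∀ y → g (- y) + 1ℤ * g (- (y + 1ℤ)) ≡ 1ℤ * g (- (y + -1ℤ))
FibRec-reflected-step g g-rec y = begin
  g (- y) + 1ℤ * g z             ≡⟨ cong₂ (λ u v → g u + v) (index₁ y) (*-identityˡ (g z)) ⟩
  g (sucℤ z) + g z               ≡⟨ g-rec z ⟨
  g (sucℤ (sucℤ z))              ≡⟨ cong g (index₂ y) ⟨
  g (- (y + -1ℤ))                ≡⟨ *-identityˡ _ ⟨
  1ℤ * g (- (y + -1ℤ))           ∎
  where
  z = - (y + 1ℤ)
  index₁ : ∀ y → - y ≡ 1ℤ + - (y + 1ℤ)
  index₁ = solve-∀
  index₂ : ∀ y → - (y + -1ℤ) ≡ 1ℤ + (1ℤ + - (y + 1ℤ))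
  index₂ = solve-∀

module CubeSums (g : ℤ → ℤ) (g-rec : FibRec g) (κ ε : ℤ)
                (g-cube : ∀ x → κ * g x ^ 3 ≡ g (+ 3 * x) + + 3 * g (- x))
                (g-reflection : ∀ x → g (- x) ≡ ε * (negOnePow x * g x)) where

  cube-sum : ∀ n s → κ * sumTo n (λ k → binom n k * g (+ k + s) ^ 3)
                     ≡ (+ 2) ^ n * g (+ (2 ℕ.* n) + + 3 * s) + + 3 * g (+ n - s)
  cube-sum n s = begin
    κ * binomialTransform n (λ k → g (+ k + s) ^ 3)
      ≡⟨ binomialTransform-* n κ _ ⟨
    binomialTransform n (λ k → κ * g (+ k + s) ^ 3)
      ≡⟨ binomialTransform-cong n split ⟩
    binomialTransform n (λ k → 1ℤ ^ k * g (+ 3 * s + + k * + 3) + + 3 * (1ℤ ^ k * g (- (s + + k * 1ℤ))))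
      ≡⟨ binomialTransform-linear n (+ 3) _ _ ⟩
    binomialSum 1ℤ (+ 3) g n (+ 3 * s) + + 3 * binomialSum 1ℤ 1ℤ (λ y → g (- y)) n s
      ≡⟨ cong₂ (λ u v → u + + 3 * v)
           (binomialSum-geometric 1ℤ (+ 3) (+ 2) (+ 2) g (FibRec-step-3 g g-rec) n (+ 3 * s))
           (binomialSum-geometric 1ℤ 1ℤ 1ℤ -1ℤ (λ y → g (- y)) (FibRec-reflected-step g g-rec) n s) ⟩
    (+ 2) ^ n * g (+ 3 * s + + n * + 2) + + 3 * (1ℤ ^ n * g (- (s + + n * -1ℤ)))
      ≡⟨ cong₂ (λ u v → (+ 2) ^ n * g u + + 3 * v) index₁ (trans (1^*-identity n _) (cong g (index₂ s (+ n)))) ⟩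
    (+ 2) ^ n * g (+ (2 ℕ.* n) + + 3 * s) + + 3 * g (+ n - s) ∎
    where
    index₀ : ∀ k s → + 3 * (k + s) ≡ + 3 * s + k * + 3
    index₀ = solve-∀
    index₀′ : ∀ k s → - (k + s) ≡ - (s + k * 1ℤ)
    index₀′ = solve-∀
    split : ∀ k → κ * g (+ k + s) ^ 3
                  ≡ 1ℤ ^ k * g (+ 3 * s + + k * + 3) + + 3 * (1ℤ ^ k * g (- (s + + k * 1ℤ)))
    split k = begin
      κ * g (+ k + s) ^ 3                                       ≡⟨ g-cube (+ k + s) ⟩
      g (+ 3 * (+ k + s)) + + 3 * g (- (+ k + s))
        ≡⟨ cong₂ (λ u v → g u + + 3 * g v) (index₀ (+ k) s) (index₀′ (+ k) s) ⟩
      g (+ 3 * s + + k * + 3) + + 3 * g (- (s + + k * 1ℤ))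
        ≡⟨ cong₂ (λ u v → u + + 3 * v) (1^*-identity k _) (1^*-identity k _) ⟨
      1ℤ ^ k * g (+ 3 * s + + k * + 3) + + 3 * (1ℤ ^ k * g (- (s + + k * 1ℤ))) ∎
    index₁ : + 3 * s + + n * + 2 ≡ + (2 ℕ.* n) + + 3 * s
    index₁ = trans (reorder s (+ n)) (cong (_+ + 3 * s) (sym (pos-* 2 n)))
      where
      reorder : ∀ s n → + 3 * s + n * + 2 ≡ + 2 * n + + 3 * s
      reorder = solve-∀
    index₂ : ∀ s n → - (s + n * -1ℤ) ≡ n - s
    index₂ = solve-∀

  -- By the reflection law g(-(k+s)) = ε (-1)^s (-1)^k g(k+s), so the second sum carries the weight (-ω)^k.
  weighted-cube-sum : ∀ ω n s →
    κ * binomialTransform n (λ k → ω ^ k * g (+ k + s) ^ 3)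
      ≡ binomialSum ω (+ 3) g n (+ 3 * s) + + 3 * (ε * negOnePow s) * binomialSum (- ω) 1ℤ g n s
  weighted-cube-sum ω n s =
    trans (sym (binomialTransform-* n κ _))
          (trans (binomialTransform-cong n split) (binomialTransform-linear n (+ 3 * (ε * negOnePow s)) _ _))
    where
    index₀ : ∀ k s → + 3 * (k + s) ≡ + 3 * s + k * + 3
    index₀ = solve-∀
    index₁ : ∀ k s → k + s ≡ s + k * 1ℤ
    index₁ = solve-∀
    split : ∀ k → κ * (ω ^ k * g (+ k + s) ^ 3)
                  ≡ ω ^ k * g (+ 3 * s + + k * + 3) + + 3 * (ε * negOnePow s) * ((- ω) ^ k * g (s + + k * 1ℤ))
    split k = begin
      κ * (ω ^ k * g (+ k + s) ^ 3)                          ≡⟨ swap κ (ω ^ k) _ ⟩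
      ω ^ k * (κ * g (+ k + s) ^ 3)                          ≡⟨ cong (ω ^ k *_) (g-cube (+ k + s)) ⟩
      ω ^ k * (g (+ 3 * (+ k + s)) + + 3 * g (- (+ k + s)))  ≡⟨ cong (λ v → ω ^ k * (g (+ 3 * (+ k + s)) + + 3 * v)) (g-reflection (+ k + s)) ⟩
      ω ^ k * (g (+ 3 * (+ k + s)) + + 3 * (ε * (negOnePow (+ k + s) * g (+ k + s))))
        ≡⟨ cong (λ σ → ω ^ k * (g (+ 3 * (+ k + s)) + + 3 * (ε * (σ * g (+ k + s))))) (negOnePow-+ k s) ⟩
      ω ^ k * (g (+ 3 * (+ k + s)) + + 3 * (ε * (negOnePowℕ k * negOnePow s * g (+ k + s))))
        ≡⟨ distribute (ω ^ k) (g (+ 3 * (+ k + s))) ε (negOnePowℕ k) (negOnePow s) (g (+ k + s)) ⟩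
      ω ^ k * g (+ 3 * (+ k + s)) + + 3 * (ε * negOnePow s) * ((negOnePowℕ k * ω ^ k) * g (+ k + s))
        ≡⟨ reindex (index₀ (+ k) s) (negOnePowℕ*^ k ω) (index₁ (+ k) s) ⟩
      ω ^ k * g (+ 3 * s + + k * + 3) + + 3 * (ε * negOnePow s) * ((- ω) ^ k * g (s + + k * 1ℤ)) ∎
      where
      swap : ∀ κ p x → κ * (p * x) ≡ p * (κ * x)
      swap = solve-∀
      distribute : ∀ p A ε e σ G → p * (A + + 3 * (ε * (e * σ * G))) ≡ p * A + + 3 * (ε * σ) * ((e * p) * G)
      distribute = solve-∀
      reindex : ∀ {u u′ v v′ w w′} → u ≡ u′ → v ≡ v′ → w ≡ w′ →
              ω ^ k * g u + + 3 * (ε * negOnePow s) * (v * g w) ≡ ω ^ k * g u′ + + 3 * (ε * negOnePow s) * (v′ * g w′)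
      reindex refl refl refl = refl

  alternating-cube-sum : ∀ n s →
    κ * sumTo n (λ k → negOnePowℕ k * binom n k * g (+ k + s) ^ 3)
      ≡ negOnePowℕ n * (+ 2) ^ n * g (+ n + + 3 * s) + + 3 * (ε * negOnePow s) * g (+ (2 ℕ.* n) + s)
  alternating-cube-sum n s = begin
    κ * sumTo n (λ k → negOnePowℕ k * binom n k * g (+ k + s) ^ 3)
      ≡⟨ cong (κ *_) (sumTo-cong n (λ k → trans (swap (negOnePowℕ k) (binom n k) _)
                                                (cong (λ e → binom n k * (e * g (+ k + s) ^ 3)) (negOnePowℕ≡-1^ k)))) ⟩
    κ * binomialTransform n (λ k → -1ℤ ^ k * g (+ k + s) ^ 3)
      ≡⟨ weighted-cube-sum -1ℤ n s ⟩
    binomialSum -1ℤ (+ 3) g n (+ 3 * s) + c * binomialSum 1ℤ 1ℤ g n s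
      ≡⟨ cong₂ (λ u v → u + c * v)
           (binomialSum-geometric -1ℤ (+ 3) (- + 2) 1ℤ g (FibRec-alternating-step-3 g g-rec) n (+ 3 * s))
           (binomialSum-geometric 1ℤ 1ℤ 1ℤ (+ 2) g (FibRec-consecutive g g-rec) n s) ⟩
    (- + 2) ^ n * g (+ 3 * s + + n * 1ℤ) + c * (1ℤ ^ n * g (s + + n * + 2))
      ≡⟨ cong₂ _+_ (cong₂ _*_ (negOnePowℕ*^ n (+ 2)) (cong g (index₁ s (+ n))))
                   (cong (c *_) (trans (cong g index₂) (sym (1^*-identity n _)))) ⟨
    negOnePowℕ n * (+ 2) ^ n * g (+ n + + 3 * s) + c * g (+ (2 ℕ.* n) + s) ∎
    where
    c = + 3 * (ε * negOnePow s)
    swap : ∀ e b x → e * b * x ≡ b * (e * x)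
    swap = solve-∀
    index₁ : ∀ s n → n + + 3 * s ≡ + 3 * s + n * 1ℤ
    index₁ = solve-∀
    index₂ : + (2 ℕ.* n) + s ≡ s + + n * + 2
    index₂ = trans (cong (_+ s) (pos-* 2 n)) (reorder s (+ n))
      where
      reorder : ∀ s n → + 2 * n + s ≡ s + n * + 2
      reorder = solve-∀

module F-cube-sums = CubeSums F F-rec (+ 5) -1ℤ F-cube F-reflection
module L-cube-sums = CubeSums L L-rec 1ℤ 1ℤ (λ x → trans (*-identityˡ _) (L-cube x))
                                             (λ x → trans (L-reflection x) (sym (*-identityˡ _)))

L-binomial-cube-sum : ∀ n s → sumTo n (λ k → binom n k * L (+ k + s) ^ 3)
                              ≡ (+ 2) ^ n * L (+ (2 ℕ.* n) + + 3 * s) + + 3 * L (+ n - s)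
L-binomial-cube-sum n s = trans (sym (*-identityˡ _)) (L-cube-sums.cube-sum n s)

F-alternating-binomial-cube-sum : ∀ n s →
  + 5 * sumTo n (λ k → negOnePowℕ k * binom n k * F (+ k + s) ^ 3)
    ≡ negOnePowℕ n * (+ 2) ^ n * F (+ n + + 3 * s) - negOnePow s * + 3 * F (+ (2 ℕ.* n) + s)
F-alternating-binomial-cube-sum n s =
  trans (F-cube-sums.alternating-cube-sum n s) (tidy (negOnePowℕ n * (+ 2) ^ n * F (+ n + + 3 * s)) (negOnePow s) (F (+ (2 ℕ.* n) + s)))
  where
  tidy : ∀ A σ G → A + + 3 * (-1ℤ * σ) * G ≡ A - σ * + 3 * G
  tidy = solve-∀

L-alternating-binomial-cube-sum : ∀ n s →
  sumTo n (λ k → negOnePowℕ k * binom n k * L (+ k + s) ^ 3)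
    ≡ negOnePowℕ n * (+ 2) ^ n * L (+ n + + 3 * s) + negOnePow s * + 3 * L (+ (2 ℕ.* n) + s)
L-alternating-binomial-cube-sum n s =
  trans (sym (*-identityˡ _))
        (trans (L-cube-sums.alternating-cube-sum n s) (tidy (negOnePowℕ n * (+ 2) ^ n * L (+ n + + 3 * s)) (negOnePow s) (L (+ (2 ℕ.* n) + s))))
  where
  tidy : ∀ A σ G → A + + 3 * (1ℤ * σ) * G ≡ A + σ * + 3 * G
  tidy = solve-∀

F-L-step-3 : ∀ y → F y + + 2 * F (y + + 3) ≡ 1ℤ * L (y + + 3)
F-L-step-3 y rewrite addition-formula F F-rec y (+ 3) | addition-formula L L-rec y (+ 3) = tidy (F y) (F (sucℤ y))
  where
  tidy : ∀ a b → a + + 2 * (+ 2 * b + + 1 * a) ≡ 1ℤ * (+ 4 * b + + 3 * a)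
  tidy = solve-∀

L-F-step-3 : ∀ y → L y + + 2 * L (y + + 3) ≡ + 5 * F (y + + 3)
L-F-step-3 y rewrite L-via-F y | addition-formula L L-rec y (+ 3) | addition-formula F F-rec y (+ 3) =
  tidy (F y) (F (sucℤ y))
  where
  tidy : ∀ a b → + 2 * b - a + + 2 * (+ 4 * b + + 3 * a) ≡ + 5 * (+ 2 * b + + 1 * a)
  tidy = solve-∀

F-L-step-1 : ∀ y → F y + - + 2 * F (y + 1ℤ) ≡ -1ℤ * L (y + + 0)
F-L-step-1 y rewrite addition-formula F F-rec y 1ℤ | addition-formula L L-rec y (+ 0) = tidy (F y) (F (sucℤ y))
  where
  tidy : ∀ a b → a + - + 2 * (+ 1 * b + + 0 * a) ≡ -1ℤ * (+ 2 * b + -1ℤ * a)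
  tidy = solve-∀

L-F-step-1 : ∀ y → L y + - + 2 * L (y + 1ℤ) ≡ - + 5 * F (y + + 0)
L-F-step-1 y rewrite L-via-F y | addition-formula L L-rec y 1ℤ | addition-formula F F-rec y (+ 0) =
  tidy (F y) (F (sucℤ y))
  where
  tidy : ∀ a b → + 2 * b - a + - + 2 * (+ 1 * b + + 2 * a) ≡ - + 5 * (+ 0 * b + + 1 * a)
  tidy = solve-∀

triple-index : ∀ n s → + 3 * s + + n * + 3 ≡ + (3 ℕ.* n) + + 3 * s
triple-index n s = trans (reorder s (+ n)) (cong (_+ + 3 * s) (sym (pos-* 3 n)))
  where
  reorder : ∀ s n → + 3 * s + n * + 3 ≡ + 3 * n + + 3 * s
  reorder = solve-∀

triple-index-suc : ∀ n s → + 3 * s + + 3 + + n * + 3 ≡ + (3 ℕ.* suc n) + + 3 * s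
triple-index-suc n s = trans (reorder s (+ n)) (triple-index (suc n) s)
  where
  reorder : ∀ s n → + 3 * s + + 3 + n * + 3 ≡ + 3 * s + (1ℤ + n) * + 3
  reorder = solve-∀

constant-index : ∀ s n → s + n * + 0 ≡ s
constant-index = solve-∀

constant-index-suc : ∀ s n → s + + 0 + n * + 0 ≡ s
constant-index-suc = solve-∀

F-weighted-binomial-cube-sum : ∀ n s → + 5 * sumTo n (λ k → binom n k * (+ 2) ^ k * F (+ k + s) ^ 3)
  ≡ binomialSum (+ 2) (+ 3) F n (+ 3 * s) + + 3 * (-1ℤ * negOnePow s) * binomialSum (- + 2) 1ℤ F n s
F-weighted-binomial-cube-sum n s =
  trans (cong (+ 5 *_) (sumTo-cong n (λ k → *-assoc (binom n k) _ _))) (F-cube-sums.weighted-cube-sum (+ 2) n s)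

L-weighted-binomial-cube-sum : ∀ n s → sumTo n (λ k → binom n k * (+ 2) ^ k * L (+ k + s) ^ 3)
  ≡ binomialSum (+ 2) (+ 3) L n (+ 3 * s) + + 3 * (1ℤ * negOnePow s) * binomialSum (- + 2) 1ℤ L n s
L-weighted-binomial-cube-sum n s =
  trans (sym (*-identityˡ _))
        (trans (cong (1ℤ *_) (sumTo-cong n (λ k → *-assoc (binom n k) _ _))) (L-cube-sums.weighted-cube-sum (+ 2) n s))

F-weighted-binomial-cube-sum-even : ∀ n s m → n ≡ 2 ℕ.* m →
  + 5 * sumTo n (λ k → binom n k * (+ 2) ^ k * F (+ k + s) ^ 3)
    ≡ (+ 5) ^ m * (F (+ (3 ℕ.* n) + + 3 * s) - negOnePow s * + 3 * F s)
F-weighted-binomial-cube-sum-even .(2 ℕ.* m) s m refl = begin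
  + 5 * sumTo n (λ k → binom n k * (+ 2) ^ k * F (+ k + s) ^ 3)
    ≡⟨ F-weighted-binomial-cube-sum n s ⟩
  binomialSum (+ 2) (+ 3) F n (+ 3 * s) + c * binomialSum (- + 2) 1ℤ F n s
    ≡⟨ cong₂ (λ u v → u + c * v)
         (binomialSum-even (+ 2) (+ 3) 1ℤ (+ 5) (+ 3) F L F-L-step-3 L-F-step-3 m (+ 3 * s))
         (binomialSum-even (- + 2) 1ℤ -1ℤ (- + 5) (+ 0) F L F-L-step-1 L-F-step-1 m s) ⟩
  (+ 5) ^ m * F (+ 3 * s + + n * + 3) + c * ((+ 5) ^ m * F (s + + n * + 0))
    ≡⟨ cong₂ (λ u v → (+ 5) ^ m * F u + c * ((+ 5) ^ m * F v)) (triple-index n s) (constant-index s (+ n)) ⟩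
  (+ 5) ^ m * F (+ (3 ℕ.* n) + + 3 * s) + c * ((+ 5) ^ m * F s)
    ≡⟨ tidy ((+ 5) ^ m) (F (+ (3 ℕ.* n) + + 3 * s)) (negOnePow s) (F s) ⟩
  (+ 5) ^ m * (F (+ (3 ℕ.* n) + + 3 * s) - negOnePow s * + 3 * F s) ∎
  where
  n = 2 ℕ.* m
  c = + 3 * (-1ℤ * negOnePow s)
  tidy : ∀ p A σ G → p * A + + 3 * (-1ℤ * σ) * (p * G) ≡ p * (A - σ * + 3 * G)
  tidy = solve-∀

F-weighted-binomial-cube-sum-odd : ∀ n s m → n ≡ 2 ℕ.* m ℕ.+ 1 →
  + 5 * sumTo n (λ k → binom n k * (+ 2) ^ k * F (+ k + s) ^ 3)
    ≡ (+ 5) ^ m * (L (+ (3 ℕ.* n) + + 3 * s) + negOnePow s * + 3 * L s)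
F-weighted-binomial-cube-sum-odd .(2 ℕ.* m ℕ.+ 1) s m refl rewrite ℕP.+-comm (2 ℕ.* m) 1 = begin
  + 5 * sumTo (suc n) (λ k → binom (suc n) k * (+ 2) ^ k * F (+ k + s) ^ 3)
    ≡⟨ F-weighted-binomial-cube-sum (suc n) s ⟩
  binomialSum (+ 2) (+ 3) F (suc n) (+ 3 * s) + c * binomialSum (- + 2) 1ℤ F (suc n) s
    ≡⟨ cong₂ (λ u v → u + c * v)
         (binomialSum-odd (+ 2) (+ 3) 1ℤ (+ 5) (+ 3) F L F-L-step-3 L-F-step-3 m (+ 3 * s))
         (binomialSum-odd (- + 2) 1ℤ -1ℤ (- + 5) (+ 0) F L F-L-step-1 L-F-step-1 m s) ⟩
  1ℤ * ((+ 5) ^ m * L (+ 3 * s + + 3 + + n * + 3)) + c * (-1ℤ * ((+ 5) ^ m * L (s + + 0 + + n * + 0)))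
    ≡⟨ cong₂ (λ u v → 1ℤ * ((+ 5) ^ m * L u) + c * (-1ℤ * ((+ 5) ^ m * L v)))
             (triple-index-suc n s) (constant-index-suc s (+ n)) ⟩
  1ℤ * ((+ 5) ^ m * L (+ (3 ℕ.* suc n) + + 3 * s)) + c * (-1ℤ * ((+ 5) ^ m * L s))
    ≡⟨ tidy ((+ 5) ^ m) (L (+ (3 ℕ.* suc n) + + 3 * s)) (negOnePow s) (L s) ⟩
  (+ 5) ^ m * (L (+ (3 ℕ.* suc n) + + 3 * s) + negOnePow s * + 3 * L s) ∎
  where
  n = 2 ℕ.* m
  c = + 3 * (-1ℤ * negOnePow s)
  tidy : ∀ p A σ G → 1ℤ * (p * A) + + 3 * (-1ℤ * σ) * (-1ℤ * (p * G)) ≡ p * (A + σ * + 3 * G)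
  tidy = solve-∀

L-weighted-binomial-cube-sum-even : ∀ n s m → n ≡ 2 ℕ.* m →
  sumTo n (λ k → binom n k * (+ 2) ^ k * L (+ k + s) ^ 3)
    ≡ (+ 5) ^ m * (L (+ (3 ℕ.* n) + + 3 * s) + negOnePow s * + 3 * L s)
L-weighted-binomial-cube-sum-even .(2 ℕ.* m) s m refl = begin
  sumTo n (λ k → binom n k * (+ 2) ^ k * L (+ k + s) ^ 3)
    ≡⟨ L-weighted-binomial-cube-sum n s ⟩
  binomialSum (+ 2) (+ 3) L n (+ 3 * s) + c * binomialSum (- + 2) 1ℤ L n s
    ≡⟨ cong₂ (λ u v → u + c * v)
         (binomialSum-even (+ 2) (+ 3) (+ 5) 1ℤ (+ 3) L F L-F-step-3 F-L-step-3 m (+ 3 * s))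
         (binomialSum-even (- + 2) 1ℤ (- + 5) -1ℤ (+ 0) L F L-F-step-1 F-L-step-1 m s) ⟩
  (+ 5) ^ m * L (+ 3 * s + + n * + 3) + c * ((+ 5) ^ m * L (s + + n * + 0))
    ≡⟨ cong₂ (λ u v → (+ 5) ^ m * L u + c * ((+ 5) ^ m * L v)) (triple-index n s) (constant-index s (+ n)) ⟩
  (+ 5) ^ m * L (+ (3 ℕ.* n) + + 3 * s) + c * ((+ 5) ^ m * L s)
    ≡⟨ tidy ((+ 5) ^ m) (L (+ (3 ℕ.* n) + + 3 * s)) (negOnePow s) (L s) ⟩
  (+ 5) ^ m * (L (+ (3 ℕ.* n) + + 3 * s) + negOnePow s * + 3 * L s) ∎
  where
  n = 2 ℕ.* m
  c = + 3 * (1ℤ * negOnePow s)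
  tidy : ∀ p A σ G → p * A + + 3 * (1ℤ * σ) * (p * G) ≡ p * (A + σ * + 3 * G)
  tidy = solve-∀

L-weighted-binomial-cube-sum-odd : ∀ n s m → n ≡ 2 ℕ.* m ℕ.+ 1 →
  sumTo n (λ k → binom n k * (+ 2) ^ k * L (+ k + s) ^ 3)
    ≡ (+ 5) ^ (m ℕ.+ 1) * (F (+ (3 ℕ.* n) + + 3 * s) - negOnePow s * + 3 * F s)
L-weighted-binomial-cube-sum-odd .(2 ℕ.* m ℕ.+ 1) s m refl rewrite ℕP.+-comm (2 ℕ.* m) 1 | ℕP.+-comm m 1 = begin
  sumTo (suc n) (λ k → binom (suc n) k * (+ 2) ^ k * L (+ k + s) ^ 3)
    ≡⟨ L-weighted-binomial-cube-sum (suc n) s ⟩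
  binomialSum (+ 2) (+ 3) L (suc n) (+ 3 * s) + c * binomialSum (- + 2) 1ℤ L (suc n) s
    ≡⟨ cong₂ (λ u v → u + c * v)
         (binomialSum-odd (+ 2) (+ 3) (+ 5) 1ℤ (+ 3) L F L-F-step-3 F-L-step-3 m (+ 3 * s))
         (binomialSum-odd (- + 2) 1ℤ (- + 5) -1ℤ (+ 0) L F L-F-step-1 F-L-step-1 m s) ⟩
  + 5 * ((+ 5) ^ m * F (+ 3 * s + + 3 + + n * + 3)) + c * (- + 5 * ((+ 5) ^ m * F (s + + 0 + + n * + 0)))
    ≡⟨ cong₂ (λ u v → + 5 * ((+ 5) ^ m * F u) + c * (- + 5 * ((+ 5) ^ m * F v)))
             (triple-index-suc n s) (constant-index-suc s (+ n)) ⟩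
  + 5 * ((+ 5) ^ m * F (+ (3 ℕ.* suc n) + + 3 * s)) + c * (- + 5 * ((+ 5) ^ m * F s))
    ≡⟨ tidy ((+ 5) ^ m) (F (+ (3 ℕ.* suc n) + + 3 * s)) (negOnePow s) (F s) ⟩
  + 5 * (+ 5) ^ m * (F (+ (3 ℕ.* suc n) + + 3 * s) - negOnePow s * + 3 * F s) ∎
  where
  n = 2 ℕ.* m
  c = + 3 * (1ℤ * negOnePow s)
  tidy : ∀ p A σ G → + 5 * (p * A) + + 3 * (1ℤ * σ) * (- + 5 * (p * G)) ≡ + 5 * p * (A - σ * + 3 * G)
  tidy = solve-∀

theorem2 : (n : ℕ) (s : ℤ) →
    ((+ 5) * sumTo n (λ k → binom n k * F ((+ k) + s) ^ 3)
        ≡ (+ 2) ^ n * F ((+ (2 ℕ.* n)) + (+ 3) * s) + (+ 3) * F ((+ n) - s))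
    × (sumTo n (λ k → binom n k * L ((+ k) + s) ^ 3)
        ≡ (+ 2) ^ n * L ((+ (2 ℕ.* n)) + (+ 3) * s) + (+ 3) * L ((+ n) - s))
    × ((+ 5) * sumTo n (λ k → negOnePowℕ k * binom n k * F ((+ k) + s) ^ 3)
        ≡ negOnePowℕ n * (+ 2) ^ n * F ((+ n) + (+ 3) * s) - negOnePow s * (+ 3) * F ((+ (2 ℕ.* n)) + s))
    × (sumTo n (λ k → negOnePowℕ k * binom n k * L ((+ k) + s) ^ 3)
        ≡ negOnePowℕ n * (+ 2) ^ n * L ((+ n) + (+ 3) * s) + negOnePow s * (+ 3) * L ((+ (2 ℕ.* n)) + s))
    × ((m : ℕ) → n ≡ 2 ℕ.* m →
        (+ 5) * sumTo n (λ k → binom n k * (+ 2) ^ k * F ((+ k) + s) ^ 3)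
          ≡ (+ 5) ^ m * (F ((+ (3 ℕ.* n)) + (+ 3) * s) - negOnePow s * (+ 3) * F s))
    × ((m : ℕ) → n ≡ 2 ℕ.* m ℕ.+ 1 →
        (+ 5) * sumTo n (λ k → binom n k * (+ 2) ^ k * F ((+ k) + s) ^ 3)
          ≡ (+ 5) ^ m * (L ((+ (3 ℕ.* n)) + (+ 3) * s) + negOnePow s * (+ 3) * L s))
    × ((m : ℕ) → n ≡ 2 ℕ.* m →
        sumTo n (λ k → binom n k * (+ 2) ^ k * L ((+ k) + s) ^ 3)
          ≡ (+ 5) ^ m * (L ((+ (3 ℕ.* n)) + (+ 3) * s) + negOnePow s * (+ 3) * L s))
    × ((m : ℕ) → n ≡ 2 ℕ.* m ℕ.+ 1 →
        sumTo n (λ k → binom n k * (+ 2) ^ k * L ((+ k) + s) ^ 3)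
          ≡ (+ 5) ^ (m ℕ.+ 1) * (F ((+ (3 ℕ.* n)) + (+ 3) * s) - negOnePow s * (+ 3) * F s))
theorem2 n s =
    F-cube-sums.cube-sum n s
  , L-binomial-cube-sum n s
  , F-alternating-binomial-cube-sum n s
  , L-alternating-binomial-cube-sum n s
  , F-weighted-binomial-cube-sum-even n s
  , F-weighted-binomial-cube-sum-odd n s
  , L-weighted-binomial-cube-sum-even n s
  , L-weighted-binomial-cube-sum-odd n s
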